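{- Let $N$ be a finite set with a binary operation $-$ and a set $T=\{t_i\}$ of maps $t_i:N\to N$ such that: for all $a,b\in N$ there is a unique $t_i\in T$ with $t_ia=b$; for all $a,b\in N$ the equation $a-x=b$ has a unique solution $x\in N$; and $a-b=t_ia-t_ib$ for all $a,b\in N$ and all $t_i\in T$. Then $(N,-)$ is a quasigroup.
   Context: A quasigroup is a set $S$ with a binary operation $\circ$ such that for all $a,b\in S$ each of the equations $a\circ x=b$ and $y\circ a=b$ has a unique solution. -}

module Defs where

open import Data.Product using (Σ; _×_; _,_)
open import Relation.Binary.PropositionalEquality using (_≡_)

∃! : ∀ {a} (A : Set a) → (A → Set) → Set a
∃! A P = Σ A (λ x → P x × (∀ y → P y → y ≡ x))

IsQuasigroup : (S : Set) → (S → S → S) → Set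
IsQuasigroup S _∘_ =
  (∀ a b → ∃! S (λ x → a ∘ x ≡ b)) × (∀ a b → ∃! S (λ y → y ∘ a ≡ b))

-- Only left division is given; right division a ↦ y with y - a = b is built from
-- the transitive family T. If a - x = b, take the t with t x = a: then
-- t a - a = t a - t x = a - x = b. For uniqueness, if y' - a = y - a, let t send y
-- to y'; invariance gives y' - t a = y - a = y' - a, so t fixes a, hence (by
-- invariance and left cancellation) t fixes every point, and y' = t y = y.
module Submission where

open import Defs
open import Data.Nat using (ℕ)
open import Data.Fin using (Fin)
open import Data.Product using (_,_; proj₁; proj₂)
open import Relation.Binary.PropositionalEquality
  using (_≡_; refl; sym; trans; cong; module ≡-Reasoning)
import Algebra.Definitions as AlgebraDefinitions

module _ {S : Set} (_-_ : S → S → S) where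

  open AlgebraDefinitions {A = S} _≡_ using (LeftCancellative)

  UniqueLeftDivision : Set
  UniqueLeftDivision = ∀ a b → ∃! S (λ x → (a - x) ≡ b)

  uniqueLeftDivision⇒cancelˡ : UniqueLeftDivision → LeftCancellative _-_
  uniqueLeftDivision⇒cancelˡ div a x y eq =
    let (_ , _ , unique) = div a (a - y) in trans (unique x eq) (sym (unique y refl))

  module _ {I : Set} (t : I → S → S)
           (transitive : ∀ a b → ∃! I (λ i → t i a ≡ b))
           (div : UniqueLeftDivision)
           (invariant : ∀ a b i → (a - b) ≡ (t i a - t i b)) where

    private
      cancelˡ : LeftCancellative _-_
      cancelˡ = uniqueLeftDivision⇒cancelˡ div

    fixes-point⇒fixes-all : ∀ i a → t i a ≡ a → ∀ c → t i c ≡ c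
    fixes-point⇒fixes-all i a fix c = cancelˡ a (t i c) c (begin
      a - t i c      ≡⟨ cong (_- t i c) (sym fix) ⟩
      t i a - t i c  ≡⟨ sym (invariant a c i) ⟩
      a - c          ∎)
      where open ≡-Reasoning

    rightDivision-unique : ∀ a y y′ → (y′ - a) ≡ (y - a) → y′ ≡ y
    rightDivision-unique a y y′ eq = begin
      y′     ≡⟨ sym ty≡y′ ⟩
      t j y  ≡⟨ fixes-point⇒fixes-all j a ta≡a y ⟩
      y      ∎
      where
      open ≡-Reasoning
      j = proj₁ (transitive y y′)
      ty≡y′ = proj₁ (proj₂ (transitive y y′))
      ta≡a : t j a ≡ a
      ta≡a = cancelˡ y′ (t j a) a (begin
        y′ - t j a     ≡⟨ cong (_- t j a) (sym ty≡y′) ⟩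
        t j y - t j a  ≡⟨ sym (invariant y a j) ⟩
        y - a          ≡⟨ sym eq ⟩
        y′ - a         ∎)

    uniqueRightDivision : ∀ a b → ∃! S (λ y → (y - a) ≡ b)
    uniqueRightDivision a b = y , y-a≡b , λ y′ y′-a≡b →
      rightDivision-unique a y y′ (trans y′-a≡b (sym y-a≡b))
      where
      open ≡-Reasoning
      x = proj₁ (div a b)
      i = proj₁ (transitive x a)
      tx≡a = proj₁ (proj₂ (transitive x a))
      y = t i a
      y-a≡b : (y - a) ≡ b
      y-a≡b = begin
        t i a - a      ≡⟨ cong (t i a -_) (sym tx≡a) ⟩
        t i a - t i x  ≡⟨ sym (invariant a x i) ⟩
        a - x          ≡⟨ proj₁ (proj₂ (div a b)) ⟩
        b              ∎

mainTheorem3 : (n : ℕ) (_-_ : Fin n → Fin n → Fin n)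
    (I : Set) (t : I → Fin n → Fin n) →
    (∀ a b → ∃! I (λ i → t i a ≡ b)) →
    (∀ a b → ∃! (Fin n) (λ x → (a - x) ≡ b)) →
    (∀ a b i → (a - b) ≡ (t i a - t i b)) →
    IsQuasigroup (Fin n) _-_
mainTheorem3 n _-_ I t transitive div invariant =
  div , uniqueRightDivision _-_ t transitive div invariant
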